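{- For every finite digraph $G=(V,E)$ and every threshold function $t:V\to\mathbb{N}$, every execution of the algorithm MTS on input $(G,t)$ outputs a target set for $G$ with thresholds $t$.
   Context: Digraphs are finite, without loops. For a digraph $G=(V,E)$ and $v\in V$, $\Gamma^{in}(v)=\{u:(u,v)\in E\}$ and $\Gamma^{out}(v)=\{u:(v,u)\in E\}$. Given thresholds $t:V\to\mathbb{N}=\{0,1,2,\dots\}$ and $S\subseteq V$, the activation process starting at $S$ is $A_0=S$ and $A_\ell=A_{\ell-1}\cup\{u\in V: |\Gamma^{in}(u)\cap A_{\ell-1}|\ge t(u)\}$ for $\ell\ge1$. $S$ is a target set for $(G,t)$ if $A_\lambda=V$ for some $\lambda\ge0$. Algorithm MTS on input $(G,t)$: set $S=\emptyset$, $L=\emptyset$, $U=V$, and for each $v\in V$ set $k(v)=t(v)$, $\delta(v)=|\Gamma^{in}(v)|$. While $U\neq\emptyset$, perform one iteration as follows. Case 1: if some $v\in U$ has $k(v)=0$, select such a $v$; for each $u\in\Gamma^{out}(v)\cap U$ set $k(u)=\max(k(u)-1,0)$ and, if $v\notin L$, set $\delta(u)=\delta(u)-1$; then set $U=U\setminus\{v\}$. Case 2: otherwise, if some $v\in U\setminus L$ has $\delta(v)<k(v)$, select such a $v$; set $S=S\cup\{v\}$; for each $u\in\Gamma^{out}(v)\cap U$ set $k(u)=k(u)-1$ and $\delta(u)=\delta(u)-1$; then set $U=U\setminus\{v\}$. Case 3: otherwise, select $v\in U\setminus L$ maximizing $\frac{k(u)}{\delta(u)(\delta(u)+1)}$ over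 $u\in U\setminus L$; for each $u\in\Gamma^{out}(v)\cap U$ set $\delta(u)=\delta(u)-1$; set $L=L\cup\{v\}$. When $U=\emptyset$, return $S$. Whenever several nodes qualify in a case, one of them is chosen arbitrarily. -}

module Defs where

open import Data.Nat using (ℕ; zero; suc; _+_; _*_; _∸_; _≤_; _<_; _≤ᵇ_)
open import Data.Bool using (Bool; true; false; _∧_; _∨_; if_then_else_)
open import Data.Fin using (Fin; _≟_)
open import Data.List using (List; length; filterᵇ; allFin)
open import Data.Product using (∃; _×_)
open import Relation.Binary.PropositionalEquality using (_≡_; _≢_)
open import Relation.Nullary using (does)
open import Relation.Binary.Construct.Closure.ReflexiveTransitive using (Star)

record Digraph (n : ℕ) : Set where
  field
    E       : Fin n → Fin n → Bool
    loopless : ∀ v → E v v ≡ false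
open Digraph public

Subset : ℕ → Set
Subset n = Fin n → Bool

inCount : ∀ {n} → Digraph n → Subset n → Fin n → ℕ
inCount G A u = length (filterᵇ (λ w → E G w u ∧ A w) (allFin _))

activated : ∀ {n} → Digraph n → (Fin n → ℕ) → Subset n → ℕ → Subset n
activated G t S zero    = S
activated G t S (suc ℓ) u =
  activated G t S ℓ u ∨ (t u ≤ᵇ inCount G (activated G t S ℓ) u)

IsTargetSet : ∀ {n} → Digraph n → (Fin n → ℕ) → Subset n → Set
IsTargetSet G t S = ∃ λ λ' → ∀ v → activated G t S λ' v ≡ true

record State (n : ℕ) : Set where
  constructor st
  field
    S U L : Subset n
    k δ   : Fin n → ℕ
open State public

initState : ∀ {n} → Digraph n → (Fin n → ℕ) → State n
initState G t = st (λ _ → false) (λ _ → true) (λ _ → false) t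
                   (λ v → inCount G (λ _ → true) v)

insert remove : ∀ {n} → Fin n → Subset n → Subset n
insert v A u = if does (u ≟ v) then true else A u
remove v A u = if does (u ≟ v) then false else A u

outU : ∀ {n} → Digraph n → State n → Fin n → Fin n → Bool
outU G s v u = E G v u ∧ U s u

-- Applicability of the cases (the case priority of MTS)
NoCase1 : ∀ {n} → State n → Set
NoCase1 s = ∀ w → U s w ≡ true → k s w ≢ 0

NoCase2 : ∀ {n} → State n → Set
NoCase2 s = ∀ w → U s w ≡ true → L s w ≡ false → k s w ≤ δ s w

-- Natural-number subtraction ∸ is used for the decrements: in Case 1 it is
-- max(k-1,0) as in the algorithm; for δ (and for k in Case 2) the quantity
-- never goes below 0 in any execution, so ∸ is the exact decrement there.
-- The Case 3 maximisation of k/(δ(δ+1)) is expressed by cross multiplication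
-- (all denominators are ≥ 2 when Case 3 applies, since then 0 < k ≤ δ).
data Step {n : ℕ} (G : Digraph n) : State n → State n → Set where
  case1 : ∀ s v → U s v ≡ true → k s v ≡ 0 →
    Step G s (st (S s) (remove v (U s)) (L s)
      (λ u → if outU G s v u then k s u ∸ 1 else k s u)
      (λ u → if outU G s v u ∧ (if L s v then false else true)
               then δ s u ∸ 1 else δ s u))
  case2 : ∀ s v → NoCase1 s → U s v ≡ true → L s v ≡ false → δ s v < k s v →
    Step G s (st (insert v (S s)) (remove v (U s)) (L s)
      (λ u → if outU G s v u then k s u ∸ 1 else k s u)
      (λ u → if outU G s v u then δ s u ∸ 1 else δ s u))
  case3 : ∀ s v → NoCase1 s → NoCase2 s → U s v ≡ true → L s v ≡ false →
    (∀ w → U s w ≡ true → L s w ≡ false →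
       k s w * (δ s v * suc (δ s v)) ≤ k s v * (δ s w * suc (δ s w))) →
    Step G s (st (S s) (U s) (insert v (L s)) (k s)
      (λ u → if outU G s v u then δ s u ∸ 1 else δ s u))

Execution : ∀ {n} → Digraph n → (Fin n → ℕ) → State n → Set
Execution G t s = Star (Step G) (initState G t) s

Finished : ∀ {n} → State n → Set
Finished s = ∀ v → U s v ≡ false

-- Correctness of MTS never looks at δ, L or the Case 3 choice: it rests on the
-- invariant that each remaining node u still satisfies t(u) ≤ k(u) + #(removed
-- in-neighbours of u), because removing a node lowers k of its remaining
-- out-neighbours by at most one. Hence a node removed in Case 1 (k = 0) is
-- activated one round after all previously removed nodes, and a node removed in
-- Case 2 lies in S; by induction on the execution every removed node, so at the
-- end every node, is activated from S.
module Submission where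

open import Defs
open import Data.Nat using (ℕ; suc; _+_; _∸_; _≤_; _<_; z≤n; s≤s)
open import Data.Nat.Properties
  using (≤⇒≤ᵇ; m≤n⇒m≤1+n; m≤m+n; m≤n+m∸n; +-suc; +-monoˡ-≤; +-monoʳ-≤; module ≤-Reasoning)
open import Data.Fin using (Fin; _≟_)
open import Data.Bool using (Bool; true; false; _∧_; not; if_then_else_)
open import Data.Bool.Properties using (T-≡; ∨-zeroʳ)
open import Data.List using ([]; _∷_; length; filterᵇ; allFin)
open import Data.List.Relation.Unary.Any using (here; there)
open import Data.List.Membership.Propositional using (_∈_)
open import Data.List.Membership.Propositional.Properties using (∈-allFin)
open import Data.Product using (∃; _×_; _,_; proj₂)
open import Data.Sum using (_⊎_; inj₁; inj₂)
open import Function using (_∘_; id; Equivalence)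
open import Relation.Binary.PropositionalEquality using (_≡_; refl; sym; trans; cong)
open import Relation.Nullary using (yes; no; contradiction)
open import Relation.Binary.Construct.Closure.ReflexiveTransitive using (fold)

module _ {A : Set} {p q : A → Bool} (p⇒q : ∀ x → p x ≡ true → q x ≡ true) where

  length-filterᵇ-mono : ∀ xs → length (filterᵇ p xs) ≤ length (filterᵇ q xs)
  length-filterᵇ-mono [] = z≤n
  length-filterᵇ-mono (x ∷ xs) with p x in px | q x in qx
  ... | true  | true  = s≤s (length-filterᵇ-mono xs)
  ... | true  | false = contradiction (trans (sym (p⇒q x px)) qx) λ ()
  ... | false | true  = m≤n⇒m≤1+n (length-filterᵇ-mono xs)
  ... | false | false = length-filterᵇ-mono xs

  length-filterᵇ-< : ∀ {y} xs → y ∈ xs → p y ≡ false → q y ≡ true →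
    length (filterᵇ p xs) < length (filterᵇ q xs)
  length-filterᵇ-< (_ ∷ xs) (here refl) py qy rewrite py | qy = s≤s (length-filterᵇ-mono xs)
  length-filterᵇ-< (x ∷ xs) (there y∈xs) py qy with p x in px | q x in qx
  ... | true  | true  = s≤s (length-filterᵇ-< xs y∈xs py qy)
  ... | true  | false = contradiction (trans (sym (p⇒q x px)) qx) λ ()
  ... | false | true  = m≤n⇒m≤1+n (length-filterᵇ-< xs y∈xs py qy)
  ... | false | false = length-filterᵇ-< xs y∈xs py qy

module _ {n : ℕ} where

  infix 4 _⊆_
  _⊆_ : Subset n → Subset n → Set
  A ⊆ B = ∀ w → A w ≡ true → B w ≡ true

  insert-self : ∀ v (A : Subset n) → insert v A v ≡ true
  insert-self v A with v ≟ v
  ... | yes _  = refl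
  ... | no v≢v = contradiction refl v≢v

  ⊆-insert : ∀ v (A : Subset n) → A ⊆ insert v A
  ⊆-insert v A w Aw with w ≟ v
  ... | yes _ = refl
  ... | no _  = Aw

  remove-self : ∀ v (A : Subset n) → remove v A v ≡ false
  remove-self v A with v ≟ v
  ... | yes _  = refl
  ... | no v≢v = contradiction refl v≢v

  remove-⊆ : ∀ v (A : Subset n) → remove v A ⊆ A
  remove-⊆ v A w Aw with w ≟ v
  ... | no _ = Aw

  not-⊆-not-remove : ∀ v (A : Subset n) → not ∘ A ⊆ not ∘ remove v A
  not-⊆-not-remove v A w ¬Aw with w ≟ v
  ... | yes _ = refl
  ... | no _  = ¬Aw

  not-remove : ∀ v (A : Subset n) w → not (remove v A w) ≡ true → w ≡ v ⊎ not (A w) ≡ true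
  not-remove v A w ¬Aw with w ≟ v
  ... | yes w≡v = inj₁ w≡v
  ... | no _    = inj₂ ¬Aw

∧-monoʳ : ∀ e {a b} → (a ≡ true → b ≡ true) → e ∧ a ≡ true → e ∧ b ≡ true
∧-monoʳ true a⇒b = a⇒b

module _ {n : ℕ} (G : Digraph n) where

  inCount-mono : ∀ {A B : Subset n} → A ⊆ B → ∀ u → inCount G A u ≤ inCount G B u
  inCount-mono A⊆B u = length-filterᵇ-mono (λ w → ∧-monoʳ (E G w u) (A⊆B w)) (allFin n)

  inCount-< : ∀ {A B : Subset n} → A ⊆ B → ∀ {v u} → A v ≡ false → B v ≡ true →
    E G v u ≡ true → inCount G A u < inCount G B u
  inCount-< {A} {B} A⊆B {v} {u} Av Bv Evu =
    length-filterᵇ-< (λ w → ∧-monoʳ (E G w u) (A⊆B w)) (allFin n) (∈-allFin v)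
      (trans (cong (_∧ A v) Evu) Av) (trans (cong (_∧ B v) Evu) Bv)

  module _ (t : Fin n → ℕ) (T : Subset n) where

    activated-⊆-suc : ∀ m → activated G t T m ⊆ activated G t T (suc m)
    activated-⊆-suc m w active rewrite active = refl

    ⊆-activated : ∀ m → T ⊆ activated G t T m
    ⊆-activated 0       w Tw = Tw
    ⊆-activated (suc m) w Tw = activated-⊆-suc m w (⊆-activated m w Tw)

    activated-threshold : ∀ m u → t u ≤ inCount G (activated G t T m) u →
      activated G t T (suc m) u ≡ true
    activated-threshold m u enough
      rewrite Equivalence.to T-≡ (≤⇒≤ᵇ enough) = ∨-zeroʳ _

module _ {n : ℕ} (G : Digraph n) (t : Fin n → ℕ) where

  ThresholdBound : Subset n → (Fin n → ℕ) → Set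
  ThresholdBound U k = ∀ u → U u ≡ true → t u ≤ k u + inCount G (not ∘ U) u

  -- Quantifying over all supersets of S is what survives S growing in Case 2.
  RemovedActivated : Subset n → Subset n → Set
  RemovedActivated S U = ∀ T → S ⊆ T → ∃ λ m → not ∘ U ⊆ activated G t T m

  Invariant : State n → Set
  Invariant s = ThresholdBound (U s) (k s) × RemovedActivated (S s) (U s)

  ThresholdBound-remove : ∀ {U k} v → U v ≡ true → ThresholdBound U k →
    ThresholdBound (remove v U) (λ u → if E G v u ∧ U u then k u ∸ 1 else k u)
  ThresholdBound-remove {U} {k} v Uv bound u U′u
    with Uu ← remove-⊆ v U u U′u | E G v u in Evu
  ... | false = begin
    t u                                   ≤⟨ bound u Uu ⟩
    k u + inCount G (not ∘ U) u           ≤⟨ +-monoʳ-≤ (k u) (inCount-mono G removed⊆ u) ⟩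
    k u + inCount G (not ∘ remove v U) u  ∎
    where open ≤-Reasoning
          removed⊆ : not ∘ U ⊆ not ∘ remove v U
          removed⊆ = not-⊆-not-remove v U
  ... | true rewrite Uu = begin
    t u                                    ≤⟨ bound u Uu ⟩
    k u + inCount G (not ∘ U) u            ≤⟨ +-monoˡ-≤ _ (m≤n+m∸n (k u) 1) ⟩
    suc (k u ∸ 1) + inCount G (not ∘ U) u  ≡⟨ sym (+-suc (k u ∸ 1) _) ⟩
    k u ∸ 1 + suc (inCount G (not ∘ U) u)  ≤⟨ +-monoʳ-≤ (k u ∸ 1) v-newly-removed ⟩
    k u ∸ 1 + inCount G (not ∘ remove v U) u ∎
    where open ≤-Reasoning
          v-newly-removed : inCount G (not ∘ U) u < inCount G (not ∘ remove v U) u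
          v-newly-removed = inCount-< G (not-⊆-not-remove v U) (cong not Uv)
            (cong not (remove-self v U)) Evu

  RemovedActivated-remove-ready : ∀ {S U k} v → U v ≡ true → k v ≡ 0 →
    ThresholdBound U k → RemovedActivated S U → RemovedActivated S (remove v U)
  RemovedActivated-remove-ready {U = U} {k} v Uv kv≡0 bound activatedFrom T S⊆T
    with m , removed⊆ ← activatedFrom T S⊆T = suc m , removed′⊆
    where
    open ≤-Reasoning
    v-ready : t v ≤ inCount G (activated G t T m) v
    v-ready = begin
      t v                              ≤⟨ bound v Uv ⟩
      k v + inCount G (not ∘ U) v       ≡⟨ cong (_+ _) kv≡0 ⟩
      inCount G (not ∘ U) v            ≤⟨ inCount-mono G removed⊆ v ⟩
      inCount G (activated G t T m) v  ∎
    removed′⊆ : not ∘ remove v U ⊆ activated G t T (suc m)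
    removed′⊆ w removed with not-remove v U w removed
    ... | inj₁ refl = activated-threshold G t T m v v-ready
    ... | inj₂ r    = activated-⊆-suc G t T m w (removed⊆ w r)

  RemovedActivated-remove-seed : ∀ {S U} v →
    RemovedActivated S U → RemovedActivated (insert v S) (remove v U)
  RemovedActivated-remove-seed {S} {U} v activatedFrom T S′⊆T
    with m , removed⊆ ← activatedFrom T (λ w → S′⊆T w ∘ ⊆-insert v S w) = m , removed′⊆
    where
    removed′⊆ : not ∘ remove v U ⊆ activated G t T m
    removed′⊆ w removed with not-remove v U w removed
    ... | inj₁ refl = ⊆-activated G t T m v (S′⊆T v (insert-self v S))
    ... | inj₂ r    = removed⊆ w r

  Invariant-step : ∀ {s s′} → Step G s s′ → Invariant s → Invariant s′
  Invariant-step (case1 s v Uv kv≡0) (bound , activatedFrom) =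
    ThresholdBound-remove v Uv bound ,
    RemovedActivated-remove-ready v Uv kv≡0 bound activatedFrom
  Invariant-step (case2 s v _ Uv _ _) (bound , activatedFrom) =
    ThresholdBound-remove v Uv bound , RemovedActivated-remove-seed v activatedFrom
  Invariant-step (case3 _ _ _ _ _ _ _) invariant = invariant

  Invariant-init : Invariant (initState G t)
  Invariant-init = (λ u _ → m≤m+n (t u) _) , λ _ _ → 0 , λ _ ()

  Invariant-execution : ∀ {s} → Execution G t s → Invariant s
  Invariant-execution execution =
    fold (λ s s′ → Invariant s → Invariant s′)
      (λ step rest → rest ∘ Invariant-step step) id execution Invariant-init

theorem1 : ∀ (n : ℕ) (G : Digraph n) (t : Fin n → ℕ) (s : State n) →
    Execution G t s → Finished s → IsTargetSet G t (S s)
theorem1 n G t s execution finished =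
  let m , removed⊆activated = proj₂ (Invariant-execution G t execution) (S s) (λ _ → id)
  in m , λ v → removed⊆activated v (cong not (finished v))
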